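{- Let $\mathcal{P}$ be an LR-vine of rank $n$ with associated forests $F_1,\dots,F_n$. Let $a_1,b_1,c_1$ be mutually distinct minimal elements of $\mathcal{P}$ such that the joins $u=a_1\vee b_1$, $v=b_1\vee c_1$ and $w=a_1\vee c_1$ exist in $\mathcal{P}$. Then there exists $k$ with $1\le k\le n$ such that one of the three $k$-joining paths $P_k(u),P_k(v),P_k(w)$ is the concatenation of the other two. As a consequence, one of the three elements $u,v,w$ is strictly greater than the other two.
   Context: Posets are finite. A graded poset has a rank function $\operatorname{rk}\colon\mathcal{P}\to\mathbb{Z}_{>0}$ with $x<y\Rightarrow\operatorname{rk}(x)<\operatorname{rk}(y)$, $\operatorname{rk}(y)=\operatorname{rk}(x)+1$ when $y$ covers $x$, and minimal elements of rank $1$; $\mathcal{P}_i$ = elements of rank $i$, $\dim(\mathcal{P})$ = number of minimal elements, $\mathcal{E}(v)$ = elements covered by $v$. A vine is a graded poset in which every non-minimal element covers exactly two elements, any two distinct elements of the same rank are covered by at most one common element, and for each $1\le i\le\operatorname{rk}(\mathcal{P})$ the graph $F_i$ (the $i$-th associated forest) with vertex set $\mathcal{P}_i$ and edge set $\{\mathcal{E}(x)\mid x\in\mathcal{P}_{i+1}\}$ is a forest; a non-minimal $x$ with $\mathcal{E}(x)=\{p,q\}$ is identified with the edge $\{p,q\}$ of $F_{\operatorname{rk}(x)-1}$. An R-vine is a vine with $\operatorname{rk}(\mathcal{P})=\dim(\mathcal{P})$, each $F_i$ a tree, and proximity: distinct elements of the same rank $i\ge2$ covered by a common element cover a common element. An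 LR-vine is a vine all of whose principal ideals $\mathcal{P}_{\le x}$ are R-vines. Joining paths: for distinct minimal $i,j$ whose join $x=i\vee j$ exists, of rank $r$, the $k$-joining paths $P_k(x)$, $1\le k\le r$, are defined by: $P_1(x)=(a_{1,1},\dots,a_{1,p_1})$ is the path in $F_1$ from $a_{1,1}=i$ to $a_{1,p_1}=j$; for $2\le k\le r$, $P_k(x)=(a_{k,1},\dots,a_{k,p_k})$ is the path in $F_k$ from $a_{k,1}=\{a_{k-1,1},a_{k-1,2}\}$ to $a_{k,p_k}=\{a_{k-1,p_{k-1}-1},a_{k-1,p_{k-1}}\}$ (these paths exist and $P_r(x)$ is the single vertex $x$). Paths are written as vertex sequences; the concatenation of $(v_1,\dots,v_{p+1})$ and $(v_{p+1},\dots,v_m)$ is $(v_1,\dots,v_m)$. -}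

module Defs where

open import Level using (0ℓ)
open import Data.Nat using (ℕ; zero; suc; _≤_; _<_)
open import Data.Fin using (Fin)
open import Data.Unit using (⊤)
open import Data.Empty using (⊥)
open import Data.Maybe using (just)
open import Data.Product using (Σ; ∃; ∃-syntax; _×_; _,_)
open import Data.Sum using (_⊎_)
open import Data.List using (List; []; _∷_; _++_; [_]; length; head; last; reverse)
open import Data.List.Relation.Unary.All using (All)
open import Data.List.Relation.Unary.Linked using (Linked)
import Data.List.Relation.Unary.Unique.Propositional as UniqueP
open import Data.List.Membership.Propositional using (_∈_)
open import Relation.Binary using (Rel; IsPartialOrder)
open import Relation.Binary.PropositionalEquality using (_≡_; _≢_)
open import Relation.Nullary using (¬_)
open import Function.Bundles using (_⇔_)

record FinPoset : Set₁ where
  field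
    N    : ℕ
    _≼_  : Rel (Fin N) 0ℓ
    isPO : IsPartialOrder _≡_ _≼_

Unique : {A : Set} → List A → Set
Unique {A} = UniqueP.Unique {A = A}

Card : {A : Set} → (A → Set) → ℕ → Set
Card {A} Q d = Σ (List A) λ l → Unique l × (∀ x → (x ∈ l) ⇔ Q x) × length l ≡ d

IsConcat : {A : Set} → List A → List A → List A → Set
IsConcat {A} l l₁ l₂ = Σ A λ v → Σ (List A) λ xs → Σ (List A) λ ys →
  (l₁ ≡ xs ++ [ v ]) × (l₂ ≡ v ∷ ys) × (l ≡ xs ++ v ∷ ys)

SameUpToRev : {A : Set} → List A → List A → Set
SameUpToRev l l' = (l' ≡ l) ⊎ (l' ≡ reverse l)

ConcatOf : {A : Set} → List A → List A → List A → Set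
ConcatOf l l₁ l₂ = ∃[ m₁ ] ∃[ m₂ ] SameUpToRev l₁ m₁ × SameUpToRev l₂ m₂ ×
  (IsConcat l m₁ m₂ ⊎ IsConcat l m₂ m₁)

module _ (P : FinPoset) where
  open FinPoset P

  El : Set
  El = Fin N

  _≺_ : El → El → Set
  x ≺ y = (x ≼ y) × (x ≢ y)

  -- Everything below is relative to an induced subposet given by S
  -- (S = everything for P itself, S = (_≼ x) for a principal ideal)
  -- and a rank function rk.

  CoversIn : (El → Set) → El → El → Set
  CoversIn S x y = S x × S y × x ≺ y × (∀ z → S z → x ≺ z → z ≺ y → ⊥)

  MinimalIn : (El → Set) → El → Set
  MinimalIn S x = S x × (∀ y → S y → y ≼ x → y ≡ x)

  IsGradedIn : (El → Set) → (El → ℕ) → Set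
  IsGradedIn S rk =
    (∀ x → S x → 1 ≤ rk x) ×
    (∀ x y → S x → S y → x ≺ y → rk x < rk y) ×
    (∀ x y → CoversIn S x y → rk y ≡ suc (rk x)) ×
    (∀ x → MinimalIn S x → rk x ≡ 1)

  RankIn : (El → Set) → (El → ℕ) → ℕ → Set
  RankIn S rk r = (∀ x → S x → rk x ≤ r) × (∃[ x ] S x × rk x ≡ r)

  DimIn : (El → Set) → ℕ → Set
  DimIn S d = Card (MinimalIn S) d

  VertexIn : (El → Set) → (El → ℕ) → ℕ → El → Set
  VertexIn S rk i p = S p × rk p ≡ i

  -- edges of F_i : {p,q} = E(x) for some x of rank i+1
  AdjIn : (El → Set) → (El → ℕ) → ℕ → El → El → Set
  AdjIn S rk i p q = rk p ≡ i × rk q ≡ i × p ≢ q ×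
    (∃[ x ] rk x ≡ suc i × CoversIn S p x × CoversIn S q x)

  IsPathIn : (El → Set) → (El → ℕ) → ℕ → El → El → List El → Set
  IsPathIn S rk i a b l = All (VertexIn S rk i) l × Linked (AdjIn S rk i) l ×
    Unique l × head l ≡ just a × last l ≡ just b

  IsCycleIn : (El → Set) → (El → ℕ) → ℕ → List El → Set
  IsCycleIn S rk i l = 3 ≤ length l × All (VertexIn S rk i) l ×
    Linked (AdjIn S rk i) l × Unique l ×
    (∃[ a ] ∃[ b ] head l ≡ just a × last l ≡ just b × AdjIn S rk i b a)

  IsForestIn : (El → Set) → (El → ℕ) → ℕ → Set
  IsForestIn S rk i = ∀ l → ¬ IsCycleIn S rk i l

  IsTreeIn : (El → Set) → (El → ℕ) → ℕ → Set
  IsTreeIn S rk i = IsForestIn S rk i ×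
    (∀ p q → VertexIn S rk i p → VertexIn S rk i q → ∃[ l ] IsPathIn S rk i p q l)

  IsVineIn : (El → Set) → (El → ℕ) → Set
  IsVineIn S rk = IsGradedIn S rk ×
    (∀ x → S x → ¬ MinimalIn S x →
       ∃[ p ] ∃[ q ] p ≢ q × CoversIn S p x × CoversIn S q x ×
         (∀ z → CoversIn S z x → z ≡ p ⊎ z ≡ q)) ×
    (∀ p q x y → p ≢ q → rk p ≡ rk q →
       CoversIn S p x → CoversIn S q x → CoversIn S p y → CoversIn S q y → x ≡ y) ×
    (∀ r → RankIn S rk r → ∀ i → 1 ≤ i → i ≤ r → IsForestIn S rk i)

  IsRVineIn : (El → Set) → (El → ℕ) → Set
  IsRVineIn S rk = IsVineIn S rk ×
    (∃[ r ] RankIn S rk r × DimIn S r × (∀ i → 1 ≤ i → i ≤ r → IsTreeIn S rk i)) ×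
    (∀ p q x → p ≢ q → rk p ≡ rk q → 2 ≤ rk p →
       CoversIn S p x → CoversIn S q x → ∃[ z ] CoversIn S z p × CoversIn S z q)

  Whole : El → Set
  Whole _ = ⊤

  Minimal : El → Set
  Minimal = MinimalIn Whole

  Covers : El → El → Set
  Covers = CoversIn Whole

  Rank : (El → ℕ) → ℕ → Set
  Rank = RankIn Whole

  IsLRVine : (El → ℕ) → Set
  IsLRVine rk = IsVineIn Whole rk × (∀ x → IsRVineIn (λ y → y ≼ x) rk)

  IsJoin : El → El → El → Set
  IsJoin a b x = a ≼ x × b ≼ x × (∀ y → a ≼ y → b ≼ y → x ≼ y)

  IsPath : (El → ℕ) → ℕ → El → El → List El → Set
  IsPath = IsPathIn Whole

  FirstEdge : List El → El → Set
  FirstEdge l y = ∃[ p ] ∃[ q ] ∃[ rest ] l ≡ p ∷ q ∷ rest × Covers p y × Covers q y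

  LastEdge : List El → El → Set
  LastEdge l y = ∃[ p ] ∃[ q ] ∃[ rest ] l ≡ rest ++ p ∷ q ∷ [] × Covers p y × Covers q y

  JP : (El → ℕ) → El → El → ℕ → List El → Set
  JP rk a b zero l = ⊥
  JP rk a b (suc zero) l = IsPath rk 1 a b l
  JP rk a b (suc (suc k)) l = ∃[ l' ] JP rk a b (suc k) l' ×
    (∃[ s ] ∃[ t ] FirstEdge l' s × LastEdge l' t × IsPath rk (suc (suc k)) s t l)

  JoiningPath : (El → ℕ) → El → El → El → ℕ → List El → Set
  JoiningPath rk a b x k l = IsJoin a b x × 1 ≤ k × k ≤ rk x × JP rk a b k l

-- In a forest, three paths joining three vertices pairwise either have one of them passing through the
-- opposite corner, and then it is the concatenation of the other two, or at every corner the two paths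
-- leave along the same edge. In the second case the elements covering these shared edges are the common
-- endpoints of the next joining paths, which therefore again form such a triangle one level up; the
-- principal ideals below u, v, w are trees, so everything stays below u, v, w. Levels are bounded by
-- rk u, so a concatenation occurs, and the corner lying on the concatenated path P_k(x) is above the
-- third minimal element, making x an upper bound of a, b, c. Strictness holds because joins of distinct
-- pairs of minimal elements are distinct.

module Submission where

open import Data.Empty using (⊥; ⊥-elim)
open import Data.Fin using () renaming (_≟_ to _≟ᶠ_)
open import Data.List using (List; []; _∷_; _++_; [_]; length; head; last; reverse)
open import Data.List.Membership.Propositional using (_∈_; _∉_)
open import Data.List.Membership.Propositional.Properties using (∈-++⁺ˡ; ∈-++⁺ʳ; ∈-++⁻; ∈-∃++)
import Data.List.Membership.DecPropositional as DecMembership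
open import Data.List.Properties using (unfold-reverse; reverse-involutive; reverse-++; ++-assoc; ∷-injective)
open import Data.List.Relation.Unary.All as All using (All; []; _∷_)
import Data.List.Relation.Unary.All.Properties as Allₚ
open import Data.List.Relation.Unary.AllPairs using ([]; _∷_)
open import Data.List.Relation.Unary.Any as Any using (Any; here; there)
import Data.List.Relation.Unary.Any.Properties as Anyₚ
open import Data.List.Relation.Unary.Linked as Linked using (Linked; []; [-]; _∷_)
import Data.List.Relation.Unary.Linked.Properties as Linkedₚ
import Data.List.Relation.Unary.Unique.Propositional.Properties as Uniqueₚ
open import Data.Maybe using (just)
open import Data.Maybe.Properties using (just-injective)
open import Data.Maybe.Relation.Binary.Connected using (Connected; just)
open import Data.Nat using (ℕ; zero; suc; _+_; _≤_; _<_; s≤s; z≤n)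
open import Data.Nat.Properties
  using (≤-refl; ≤-reflexive; ≤-trans; ≤-antisym; <⇒≤; <-irrefl; n≤1+n; 1+n≰n; m≤m+n; +-suc)
open import Data.Product using (∃-syntax; _×_; _,_; proj₁; proj₂)
open import Data.Sum as Sum using (_⊎_; inj₁; inj₂; [_,_]′)
open import Data.Unit using (tt)
open import Relation.Binary using (IsPartialOrder)
open import Relation.Binary.Definitions using (DecidableEquality)
open import Relation.Binary.PropositionalEquality
  using (_≡_; _≢_; refl; sym; trans; cong; subst; subst₂; ≢-sym)
open import Relation.Nullary using (¬_; yes; no)

open import Defs

module _ {A : Set} where

  head-++-∷ : ∀ (xs : List A) y ys zs → head (xs ++ y ∷ ys) ≡ head (xs ++ y ∷ zs)
  head-++-∷ []       y ys zs = refl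
  head-++-∷ (x ∷ xs) y ys zs = refl

  last-++-∷ : ∀ (xs : List A) y ys → last (xs ++ y ∷ ys) ≡ last (y ∷ ys)
  last-++-∷ []            y ys = refl
  last-++-∷ (x ∷ [])      y ys = refl
  last-++-∷ (x ∷ x' ∷ xs) y ys = last-++-∷ (x' ∷ xs) y ys

  last-reverse : ∀ (l : List A) → last (reverse l) ≡ head l
  last-reverse []       = refl
  last-reverse (x ∷ xs) rewrite unfold-reverse x xs = last-++-∷ (reverse xs) x []

  head-reverse : ∀ (l : List A) → head (reverse l) ≡ last l
  head-reverse l = trans (sym (last-reverse (reverse l))) (cong last (reverse-involutive l))

  head⇒∈ : ∀ {l : List A} {x} → head l ≡ just x → x ∈ l
  head⇒∈ {y ∷ l} refl = here refl

  last⇒∈ : ∀ {l : List A} {x} → last l ≡ just x → x ∈ l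
  last⇒∈ {y ∷ []}    refl = here refl
  last⇒∈ {y ∷ z ∷ l} eq   = there (last⇒∈ {z ∷ l} eq)

  ∈-++-∷ʳ : ∀ (xs : List A) {y ys z} → z ∈ xs ++ [ y ] → z ∈ xs ++ y ∷ ys
  ∈-++-∷ʳ xs z∈ with ∈-++⁻ xs z∈
  ... | inj₁ z∈xs        = ∈-++⁺ˡ z∈xs
  ... | inj₂ (here refl) = ∈-++⁺ʳ xs (here refl)

  All-reverse : ∀ {P : A → Set} {l} → All P l → All P (reverse l)
  All-reverse ps = All.tabulate (λ x∈ → All.lookup ps (Anyₚ.reverse⁻ x∈))

  Unique-∷⁻ : ∀ {x} {xs : List A} → Unique (x ∷ xs) → x ∉ xs
  Unique-∷⁻ (x≢xs ∷ _) x∈ = All.lookup x≢xs x∈ refl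

  Unique-last-head : ∀ {x} {r : List A} → Unique (x ∷ r) → last (x ∷ r) ≡ just x → r ≡ []
  Unique-last-head {r = []}    _    _ = refl
  Unique-last-head {r = z ∷ r} uniq t = ⊥-elim (Unique-∷⁻ uniq (last⇒∈ {l = z ∷ r} t))

  Unique-++⁻ˡ : ∀ (xs : List A) {ys} → Unique (xs ++ ys) → Unique xs
  Unique-++⁻ˡ []       _           = []
  Unique-++⁻ˡ (x ∷ xs) (x≢ ∷ uniq) = Allₚ.++⁻ˡ xs x≢ ∷ Unique-++⁻ˡ xs uniq

  Unique-++⁻ʳ : ∀ (xs : List A) {ys} → Unique (xs ++ ys) → Unique ys
  Unique-++⁻ʳ []       uniq       = uniq
  Unique-++⁻ʳ (x ∷ xs) (_ ∷ uniq) = Unique-++⁻ʳ xs uniq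

  Unique-reverse : ∀ {l : List A} → Unique l → Unique (reverse l)
  Unique-reverse {[]}     []           = []
  Unique-reverse {x ∷ xs} (x∉xs ∷ uniq) rewrite unfold-reverse x xs =
    Uniqueₚ.++⁺ (Unique-reverse uniq) ([] ∷ [])
      λ { (x∈ , here refl) → All.lookup x∉xs (Anyₚ.reverse⁻ x∈) refl }

  module _ {R : A → A → Set} where

    Linked-++ : ∀ {xs ys a b} → Linked R xs → last xs ≡ just a → R a b → head ys ≡ just b →
      Linked R ys → Linked R (xs ++ ys)
    Linked-++ rxs ea r eb rys = Linkedₚ.++⁺ rxs (subst₂ (Connected R) (sym ea) (sym eb) (just r)) rys

    Linked-++-join : ∀ (xs : List A) {y ys} → Linked R (xs ++ [ y ]) → Linked R (y ∷ ys) →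
      Linked R (xs ++ y ∷ ys)
    Linked-++-join []            _           rys = rys
    Linked-++-join (x ∷ [])      (r ∷ _)     rys = r ∷ rys
    Linked-++-join (x ∷ x' ∷ xs) (r ∷ rxs)   rys = r ∷ Linked-++-join (x' ∷ xs) rxs rys

    Linked-++⁻ˡ : ∀ (xs : List A) {ys} → Linked R (xs ++ ys) → Linked R xs
    Linked-++⁻ˡ []            _         = []
    Linked-++⁻ˡ (x ∷ [])      _         = [-]
    Linked-++⁻ˡ (x ∷ x' ∷ xs) (r ∷ rxs) = r ∷ Linked-++⁻ˡ (x' ∷ xs) rxs

    Linked-last : ∀ {x y r} → Linked R (x ∷ y ∷ r) →
      ∃[ rest ] ∃[ p ] ∃[ q ] x ∷ y ∷ r ≡ rest ++ p ∷ q ∷ [] × R p q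
    Linked-last {x} {y} {[]}    (r ∷ _)  = [] , x , y , refl , r
    Linked-last {x} {r = _ ∷ _} (_ ∷ rs) with Linked-last rs
    ... | rest , p , q , eq , rpq = x ∷ rest , p , q , cong (x ∷_) eq , rpq

    Linked-reverse : (∀ {x y} → R x y → R y x) → ∀ {l} → Linked R l → Linked R (reverse l)
    Linked-reverse sym-R {[]}         _ = []
    Linked-reverse sym-R {x ∷ []}     _ = [-]
    Linked-reverse sym-R {x ∷ y ∷ xs} (r ∷ rxs) rewrite unfold-reverse x (y ∷ xs) =
      Linked-++ (Linked-reverse sym-R rxs) (last-reverse (y ∷ xs)) (sym-R r) refl [-]

  last-two : ∀ {p q r e f} (rest : List A) → p ∷ q ∷ r ≡ rest ++ e ∷ f ∷ [] →
    (e ≡ p × f ≡ q) ⊎ (e ∈ q ∷ r × f ∈ q ∷ r)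
  last-two []                  refl = inj₁ (refl , refl)
  last-two {q = q} {r} {e} {f} (_ ∷ rest) eq =
    inj₂ (subst (e ∈_) (sym tail≡) (∈-++⁺ʳ rest (here refl)) ,
          subst (f ∈_) (sym tail≡) (∈-++⁺ʳ rest (there (here refl))))
    where
    tail≡ : q ∷ r ≡ rest ++ e ∷ f ∷ []
    tail≡ = proj₂ (∷-injective eq)

  SameUpToRev-reverseˡ : ∀ {l m : List A} → SameUpToRev (reverse l) m → SameUpToRev l m
  SameUpToRev-reverseˡ     (inj₁ refl) = inj₂ refl
  SameUpToRev-reverseˡ {l} (inj₂ refl) = inj₁ (reverse-involutive l)

  SameUpToRev-reverseʳ : ∀ {l m : List A} → SameUpToRev l m → SameUpToRev l (reverse m)
  SameUpToRev-reverseʳ     (inj₁ refl) = inj₂ refl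
  SameUpToRev-reverseʳ {l} (inj₂ refl) = inj₁ (reverse-involutive l)

  IsConcat-reverse : ∀ {l m₁ m₂ : List A} → IsConcat (reverse l) m₁ m₂ → IsConcat l (reverse m₂) (reverse m₁)
  IsConcat-reverse {l} (v , xs , ys , refl , refl , eq) =
    v , reverse ys , reverse xs , unfold-reverse v ys , reverse-++ xs [ v ] , l≡
    where
    l≡ : l ≡ reverse ys ++ v ∷ reverse xs
    l≡ = trans (sym (reverse-involutive l)) (trans (cong reverse eq) (trans (reverse-++ xs (v ∷ ys))
           (trans (cong (_++ reverse xs) (unfold-reverse v ys)) (++-assoc (reverse ys) [ v ] (reverse xs)))))

  ConcatOf-reverse : ∀ {l l₁ l₂ : List A} → ConcatOf (reverse l) l₁ l₂ → ConcatOf l l₁ l₂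
  ConcatOf-reverse {l} (m₁ , m₂ , s₁ , s₂ , c) =
    reverse m₁ , reverse m₂ , SameUpToRev-reverseʳ s₁ , SameUpToRev-reverseʳ s₂ , swap c
    where
    swap : IsConcat (reverse l) m₁ m₂ ⊎ IsConcat (reverse l) m₂ m₁ →
           IsConcat l (reverse m₁) (reverse m₂) ⊎ IsConcat l (reverse m₂) (reverse m₁)
    swap (inj₁ c₁₂) = inj₂ (IsConcat-reverse c₁₂)
    swap (inj₂ c₂₁) = inj₁ (IsConcat-reverse c₂₁)

  ConcatOf-reverseˡ : ∀ {l l₁ l₂ : List A} → ConcatOf l (reverse l₁) l₂ → ConcatOf l l₁ l₂
  ConcatOf-reverseˡ (m₁ , m₂ , s₁ , s₂ , c) = m₁ , m₂ , SameUpToRev-reverseˡ s₁ , s₂ , c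

  ConcatOf-reverseʳ : ∀ {l l₁ l₂ : List A} → ConcatOf l l₁ (reverse l₂) → ConcatOf l l₁ l₂
  ConcatOf-reverseʳ (m₁ , m₂ , s₁ , s₂ , c) = m₁ , m₂ , s₁ , SameUpToRev-reverseˡ s₂ , c

  SameFirstStep : List A → List A → Set
  SameFirstStep l₁ l₂ = ∃[ x ] ∃[ p ] ∃[ r₁ ] ∃[ r₂ ] l₁ ≡ x ∷ p ∷ r₁ × l₂ ≡ x ∷ p ∷ r₂

  SameFirstStep⇒long : ∀ {l₁ l₂ : List A} → SameFirstStep l₁ l₂ → 2 ≤ length l₁ × 2 ≤ length l₂
  SameFirstStep⇒long (_ , _ , _ , _ , refl , refl) = s≤s (s≤s z≤n) , s≤s (s≤s z≤n)

  -- For paths l₁ : α → β, l₂ : β → γ and l₃ : α → γ: at each corner the two paths leave along one edge.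
  SharedCorners : List A → List A → List A → Set
  SharedCorners l₁ l₂ l₃ =
    SameFirstStep l₁ l₃ × SameFirstStep (reverse l₁) l₂ × SameFirstStep (reverse l₂) (reverse l₃)

module Paths {A : Set} (_≟_ : DecidableEquality A) (V : A → Set) (Adj : A → A → Set)
             (Adj-sym : ∀ {x y} → Adj x y → Adj y x) where

  private
    module Membership = DecMembership _≟_

  Path : A → A → List A → Set
  Path a b l = All V l × Linked Adj l × Unique l × head l ≡ just a × last l ≡ just b

  Cycle : List A → Set
  Cycle l = 3 ≤ length l × All V l × Linked Adj l × Unique l ×
    (∃[ a ] ∃[ b ] head l ≡ just a × last l ≡ just b × Adj b a)

  Forest : Set
  Forest = ∀ l → ¬ Cycle l

  path-reverse : ∀ {a b l} → Path a b l → Path b a (reverse l)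
  path-reverse {l = l} (vs , lk , uniq , h , t) =
    All-reverse vs , Linked-reverse Adj-sym lk , Unique-reverse uniq ,
    trans (head-reverse l) t , trans (last-reverse l) h

  path-tail : ∀ {a b x xs} → Path a b (a ∷ x ∷ xs) → Path x b (x ∷ xs)
  path-tail (_ ∷ vs , _ ∷ lk , _ ∷ uniq , _ , t) = vs , lk , uniq , refl , t

  path-ends-distinct : ∀ {a b l} → Path a b l → 2 ≤ length l → a ≢ b
  path-ends-distinct {l = []}        _ ()
  path-ends-distinct {l = _ ∷ []}    _ (s≤s ())
  path-ends-distinct {l = _ ∷ y ∷ r} (_ , _ , uniq , refl , t) _ refl = Unique-∷⁻ uniq (last⇒∈ {l = y ∷ r} t)

  path-ends-unique : ∀ {a a' b b' l} → Path a b l → Path a' b' l → a ≡ a' × b ≡ b'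
  path-ends-unique (_ , _ , _ , h , t) (_ , _ , _ , h' , t') =
    just-injective (trans (sym h) h') , just-injective (trans (sym t) t')

  path-prefix : ∀ {a b} xs {y ys} → Path a b (xs ++ y ∷ ys) → Path a y (xs ++ [ y ])
  path-prefix xs {y} {ys} (vs , lk , uniq , h , _) =
    Allₚ.++⁻ˡ (xs ++ [ y ]) (subst (All V) split vs) ,
    Linked-++⁻ˡ (xs ++ [ y ]) (subst (Linked Adj) split lk) ,
    Unique-++⁻ˡ (xs ++ [ y ]) (subst Unique split uniq) ,
    trans (head-++-∷ xs y [] ys) h , last-++-∷ xs y []
    where
    split : xs ++ y ∷ ys ≡ (xs ++ [ y ]) ++ ys
    split = sym (++-assoc xs [ y ] ys)

  path-prefix-to : ∀ {a b l y} → Path a b l → y ∈ l →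
    ∃[ xs ] ∃[ ys ] l ≡ xs ++ y ∷ ys × Path a y (xs ++ [ y ])
  path-prefix-to path y∈ with ∈-∃++ y∈
  ... | xs , ys , refl = xs , ys , refl , path-prefix xs path

  path-++ : ∀ {a w b} xs {ys} → Path a w (xs ++ [ w ]) → Path w b (w ∷ ys) →
    (∀ {z} → z ∈ xs → z ∉ w ∷ ys) → Path a b (xs ++ w ∷ ys)
  path-++ {w = w} xs {ys} (vs₁ , lk₁ , uniq₁ , h₁ , _) (vs₂ , lk₂ , uniq₂ , _ , t₂) disjoint =
    Allₚ.++⁺ (Allₚ.++⁻ˡ xs vs₁) vs₂ , Linked-++-join xs lk₁ lk₂ ,
    Uniqueₚ.++⁺ (Unique-++⁻ˡ xs uniq₁) uniq₂ (λ (z∈xs , z∈) → disjoint z∈xs z∈) ,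
    trans (head-++-∷ xs w ys []) h₁ , trans (last-++-∷ xs w ys) t₂

  cycle-close : ∀ {x p q L} → V x → Adj x p → Adj x q → p ≢ q → Path p q L → x ∉ L → Cycle (x ∷ L)
  cycle-close {L = []}          _  _   _   _   (_ , _ , _ , () , _) _
  cycle-close {L = y ∷ []}      _  _   _   p≢q (_ , _ , _ , refl , refl) _ = ⊥-elim (p≢q refl)
  cycle-close {x} {L = y ∷ z ∷ L} vx axp axq _ (vs , lk , uniq , refl , t) x∉ =
    s≤s (s≤s (s≤s z≤n)) , vx ∷ vs , axp ∷ lk ,
    All.tabulate (λ z∈ x≡z → x∉ (subst (_∈ y ∷ z ∷ L) (sym x≡z) z∈)) ∷ uniq ,
    x , _ , refl , t , Adj-sym axq

  module _ (forest : Forest) where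

    private
      first-common : ∀ (xs ys : List A) → Any (_∈ ys) xs →
        ∃[ pre ] ∃[ w ] ∃[ post ] xs ≡ pre ++ w ∷ post × w ∈ ys × All (_∉ ys) pre
      first-common (x ∷ xs) ys any with x Membership.∈? ys
      ... | yes x∈ys = [] , x , xs , refl , x∈ys , []
      ... | no x∉ys with any
      ...   | here x∈ys = ⊥-elim (x∉ys x∈ys)
      ...   | there any' with first-common xs ys any'
      ...     | pre , w , post , refl , w∈ys , pre∉ys = x ∷ pre , w , post , refl , w∈ys , x∉ys ∷ pre∉ys

    -- Two routes from distinct neighbours of x to a common vertex, both avoiding x, would close a cycle
    -- through x: follow the first until it meets the second, then return along the second.
    neighbours-disconnected : ∀ {x p q b l₁ l₂} → V x → Adj x p → Adj x q → p ≢ q →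
      Path p b l₁ → Path q b l₂ → x ∉ l₁ → x ∉ l₂ → ⊥
    neighbours-disconnected {x} {p} {q} {l₁ = l₁} {l₂} vx axp axq p≢q
      path₁@(_ , _ , _ , _ , t₁) path₂@(_ , _ , _ , _ , t₂) x∉l₁ x∉l₂
      with first-common l₁ l₂ (Any.map (λ { refl → last⇒∈ {l = l₂} t₂ }) (last⇒∈ {l = l₁} t₁))
    ... | pre , w , post , refl , w∈l₂ , pre∉l₂ with path-prefix-to path₂ w∈l₂
    ... | pre' , post' , refl , back =
      forest (x ∷ pre ++ w ∷ reverse pre') (cycle-close vx axp axq p≢q route x∉route)
      where
      returns : ∀ {z} → z ∈ w ∷ reverse pre' → z ∈ pre' ++ w ∷ post'
      returns (here refl) = ∈-++⁺ʳ pre' (here refl)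
      returns (there z∈)  = ∈-++⁺ˡ (Anyₚ.reverse⁻ {xs = pre'} z∈)
      route : Path p q (pre ++ w ∷ reverse pre')
      route = path-++ pre (path-prefix pre path₁)
                (subst (Path w q) (reverse-++ pre' [ w ]) (path-reverse back))
                (λ z∈pre z∈ → All.lookup pre∉l₂ z∈pre (returns z∈))
      x∉route : x ∉ pre ++ w ∷ reverse pre'
      x∉route x∈ = [ (λ x∈pre → x∉l₁ (∈-++⁺ˡ x∈pre)) , (λ x∈' → x∉l₂ (returns x∈')) ]′ (∈-++⁻ pre x∈)

    path-unique : ∀ {a b l l'} → Path a b l → Path a b l' → l ≡ l'
    path-unique {l = []} (_ , _ , _ , () , _) _
    path-unique {l = _ ∷ _} {[]} _ (_ , _ , _ , () , _)
    path-unique {l = x ∷ xs} {_ ∷ ys} path₁@(_ , _ , _ , refl , _) path₂@(_ , _ , _ , refl , _) =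
      cong (x ∷_) (tails xs ys path₁ path₂)
      where
      tails : ∀ {x b} xs ys → Path x b (x ∷ xs) → Path x b (x ∷ ys) → xs ≡ ys
      tails []       []       _ _ = refl
      tails []       (y ∷ ys) (_ , _ , _ , _ , refl) (_ , _ , uniq , _ , t) =
        ⊥-elim (Unique-∷⁻ uniq (last⇒∈ {l = y ∷ ys} t))
      tails (y ∷ ys) []       (_ , _ , uniq , _ , t) (_ , _ , _ , _ , refl) =
        ⊥-elim (Unique-∷⁻ uniq (last⇒∈ {l = y ∷ ys} t))
      tails (p ∷ xs) (q ∷ ys) path₁@(vx ∷ _ , axp ∷ _ , uniq₁ , _) path₂@(_ , axq ∷ _ , uniq₂ , _) with p ≟ q
      ... | yes refl = cong (p ∷_) (tails xs ys (path-tail path₁) (path-tail path₂))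
      ... | no p≢q   = ⊥-elim (neighbours-disconnected vx axp axq p≢q (path-tail path₁) (path-tail path₂)
                                 (Unique-∷⁻ uniq₁) (Unique-∷⁻ uniq₂))

    path-branch : ∀ {x y z p q r₁ r₂} → Path x y (x ∷ p ∷ r₁) → Path x z (x ∷ q ∷ r₂) → p ≢ q →
      Path y z (reverse (p ∷ r₁) ++ x ∷ q ∷ r₂)
    path-branch {x} {y} {p = p} {q} {r₁} {r₂}
      path₁@(vx ∷ _ , axp ∷ _ , uniq₁ , _) path₂@(_ , axq ∷ _ , uniq₂ , _) p≢q =
      path-++ (reverse (p ∷ r₁)) (subst (Path y x) (unfold-reverse x (p ∷ r₁)) (path-reverse path₁))
        path₂ disjoint
      where
      avoids-x : ∀ {w} zs ws → x ∉ zs ++ w ∷ ws → x ∉ zs ++ [ w ]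
      avoids-x zs ws x∉ x∈ = x∉ (∈-++-∷ʳ zs x∈)
      disjoint : ∀ {z} → z ∈ reverse (p ∷ r₁) → z ∉ x ∷ q ∷ r₂
      disjoint z∈₁ (here refl) = Unique-∷⁻ uniq₁ (Anyₚ.reverse⁻ z∈₁)
      disjoint z∈₁ (there z∈₂)
        with path-prefix-to (path-tail path₁) (Anyₚ.reverse⁻ z∈₁) | path-prefix-to (path-tail path₂) z∈₂
      ... | pre₁ , post₁ , e₁ , prefix₁ | pre₂ , post₂ , e₂ , prefix₂ =
        neighbours-disconnected vx axp axq p≢q prefix₁ prefix₂
          (avoids-x pre₁ post₁ (subst (x ∉_) e₁ (Unique-∷⁻ uniq₁)))
          (avoids-x pre₂ post₂ (subst (x ∉_) e₂ (Unique-∷⁻ uniq₂)))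

    path-no-backtrack : ∀ {α β β' p q r₁ r₂} → Path α β (p ∷ q ∷ r₁) → Path q β' (q ∷ p ∷ r₂) →
      β' ∈ q ∷ r₁ → ⊥
    path-no-backtrack {p = p} path₁@(_ , _ , uniq₁ , refl , _) path₂ β'∈
      with path-prefix-to (path-tail path₁) β'∈
    ... | pre , post , e , prefix =
      Unique-∷⁻ uniq₁ (subst (p ∈_) (sym e) (∈-++-∷ʳ pre p∈prefix))
      where
      p∈prefix : p ∈ pre ++ [ _ ]
      p∈prefix = subst (p ∈_) (sym (path-unique prefix path₂)) (there (here refl))

    corner : ∀ {x y z l₁ l₂ l₃} → Path x y l₁ → Path x z l₂ → Path y z l₃ →
      (x ∈ l₃ × ConcatOf l₃ l₁ l₂) ⊎ SameFirstStep l₁ l₂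
    corner {l₁ = []} (_ , _ , _ , () , _) _ _
    corner {l₂ = []} _ (_ , _ , _ , () , _) _
    corner {x} {l₁ = _ ∷ []} {_ ∷ r₂} {l₃} (_ , _ , _ , refl , refl) path₂@(_ , _ , _ , refl , _) path₃ =
      inj₁ (subst (x ∈_) (sym l₃≡) (here refl) ,
            x ∷ [] , x ∷ r₂ , inj₁ refl , inj₁ refl , inj₁ (x , [] , r₂ , refl , refl , l₃≡))
      where
      l₃≡ : l₃ ≡ x ∷ r₂
      l₃≡ = path-unique path₃ path₂
    corner {x} {l₁ = _ ∷ r₁} {_ ∷ []} {l₃} path₁@(_ , _ , _ , refl , _) (_ , _ , _ , refl , refl) path₃ =
      inj₁ (subst (x ∈_) (sym l₃≡) (∈-++⁺ʳ (reverse r₁) (here refl)) ,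
            reverse (x ∷ r₁) , x ∷ [] , inj₂ refl , inj₁ refl ,
            inj₁ (x , reverse r₁ , [] , unfold-reverse x r₁ , refl , l₃≡))
      where
      l₃≡ : l₃ ≡ reverse r₁ ++ [ x ]
      l₃≡ = trans (path-unique path₃ (path-reverse path₁)) (unfold-reverse x r₁)
    corner {x} {l₁ = _ ∷ p ∷ r₁} {_ ∷ q ∷ r₂} {l₃}
      path₁@(_ , _ , _ , refl , _) path₂@(_ , _ , _ , refl , _) path₃ with p ≟ q
    ... | yes refl = inj₂ (x , p , r₁ , r₂ , refl , refl)
    ... | no p≢q =
      inj₁ (subst (x ∈_) (sym l₃≡) (∈-++⁺ʳ (reverse (p ∷ r₁)) (here refl)) ,
            reverse (x ∷ p ∷ r₁) , x ∷ q ∷ r₂ , inj₂ refl , inj₁ refl ,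
            inj₁ (x , reverse (p ∷ r₁) , q ∷ r₂ , unfold-reverse x (p ∷ r₁) , refl , l₃≡))
      where
      l₃≡ : l₃ ≡ reverse (p ∷ r₁) ++ x ∷ q ∷ r₂
      l₃≡ = path-unique path₃ (path-branch path₁ path₂ p≢q)

    triangle : ∀ {α β γ l₁ l₂ l₃} → Path α β l₁ → Path β γ l₂ → Path α γ l₃ →
      (γ ∈ l₁ × ConcatOf l₁ l₂ l₃) ⊎ (α ∈ l₂ × ConcatOf l₂ l₁ l₃) ⊎ (β ∈ l₃ × ConcatOf l₃ l₁ l₂) ⊎
      SharedCorners l₁ l₂ l₃
    triangle path₁ path₂ path₃ with corner path₁ path₃ path₂
    ... | inj₁ at-α = inj₂ (inj₁ at-α)
    ... | inj₂ same-α with corner (path-reverse path₁) path₂ path₃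
    ...   | inj₁ (β∈ , c) = inj₂ (inj₂ (inj₁ (β∈ , ConcatOf-reverseˡ c)))
    ...   | inj₂ same-β with corner (path-reverse path₂) (path-reverse path₃) (path-reverse path₁)
    ...     | inj₁ (γ∈ , c) =
      inj₁ (Anyₚ.reverse⁻ γ∈ , ConcatOf-reverseʳ (ConcatOf-reverseˡ (ConcatOf-reverse c)))
    ...     | inj₂ same-γ   = inj₂ (inj₂ (inj₂ (same-α , same-β , same-γ)))

module Vine (P : FinPoset) (rk : El P → ℕ) (n : ℕ) (lr : IsLRVine P rk) (rank-n : Rank P rk n) where

  open FinPoset P using (_≼_; isPO)

  private
    module ≼ = IsPartialOrder isPO

  rank-< : ∀ {x y} → _≺_ P x y → rk x < rk y
  rank-< = proj₁ (proj₂ (proj₁ (proj₁ lr))) _ _ tt tt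

  rank-minimal : ∀ {a} → Minimal P a → rk a ≡ 1
  rank-minimal = proj₂ (proj₂ (proj₂ (proj₁ (proj₁ lr)))) _

  rank-≤-n : ∀ x → rk x ≤ n
  rank-≤-n x = proj₁ rank-n x tt

  rank-mono : ∀ {x y} → x ≼ y → rk x ≤ rk y
  rank-mono {x} {y} x≼y with x ≟ᶠ y
  ... | yes refl = ≤-refl
  ... | no x≢y   = <⇒≤ (rank-< (x≼y , x≢y))

  ≼-rank-≡ : ∀ {x y} → x ≼ y → rk x ≡ rk y → x ≡ y
  ≼-rank-≡ {x} {y} x≼y eq with x ≟ᶠ y
  ... | yes x≡y = x≡y
  ... | no x≢y  = ⊥-elim (<-irrefl eq (rank-< (x≼y , x≢y)))

  covers⇒≼ : ∀ {p x} → Covers P p x → p ≼ x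
  covers⇒≼ (_ , _ , (p≼x , _) , _) = p≼x

  covers⇒≢ : ∀ {p x} → Covers P p x → p ≢ x
  covers⇒≢ (_ , _ , (_ , p≢x) , _) = p≢x

  common-cover-unique : ∀ {p q s s'} → p ≢ q → rk p ≡ rk q →
    Covers P p s → Covers P q s → Covers P p s' → Covers P q s' → s ≡ s'
  common-cover-unique = proj₁ (proj₂ (proj₂ (proj₁ lr))) _ _ _ _

  covered-pair : ∀ {p q r s} → Covers P p s → Covers P q s → p ≢ q → Covers P r s → r ≡ p ⊎ r ≡ q
  covered-pair {p} {q} {r} {s} cp cq p≢q cr
    with proj₁ (proj₂ (proj₁ lr)) s tt (λ min → covers⇒≢ cp (proj₂ min p tt (covers⇒≼ cp)))
  ... | _ , _ , _ , _ , _ , only with only p cp | only q cq | only r cr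
  ... | inj₁ refl | inj₁ refl | _         = ⊥-elim (p≢q refl)
  ... | inj₂ refl | inj₂ refl | _         = ⊥-elim (p≢q refl)
  ... | inj₁ refl | inj₂ refl | inj₁ refl = inj₁ refl
  ... | inj₁ refl | inj₂ refl | inj₂ refl = inj₂ refl
  ... | inj₂ refl | inj₁ refl | inj₁ refl = inj₂ refl
  ... | inj₂ refl | inj₁ refl | inj₂ refl = inj₁ refl

  Adj-sym : ∀ {i x y} → AdjIn P (Whole P) rk i x y → AdjIn P (Whole P) rk i y x
  Adj-sym (rx , ry , x≢y , s , rs , cx , cy) = ry , rx , (λ eq → x≢y (sym eq)) , s , rs , cy , cx

  module F (i : ℕ) = Paths _≟ᶠ_ (VertexIn P (Whole P) rk i) (AdjIn P (Whole P) rk i) Adj-sym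

  forest-of-path : ∀ {i a b l} → 1 ≤ i → IsPath P rk i a b l → F.Forest i
  forest-of-path {l = []}    _   (_ , _ , _ , () , _)
  forest-of-path {i} {l = x ∷ _} 1≤i ((_ , rx) ∷ _ , _) =
    proj₂ (proj₂ (proj₂ (proj₁ lr))) n rank-n i 1≤i (subst (_≤ n) rx (rank-≤-n x))

  vertex-rank : ∀ {i p l} → All (VertexIn P (Whole P) rk i) l → p ∈ l → rk p ≡ i
  vertex-rank vs p∈ = proj₂ (All.lookup vs p∈)

  path-level-≤ : ∀ {i a b l x} → IsPath P rk i a b l → All (_≼ x) l → i ≤ rk x
  path-level-≤ (vs , _ , _ , h , _) below =
    subst (_≤ _) (vertex-rank vs (head⇒∈ h)) (rank-mono (All.lookup below (head⇒∈ h)))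

  edge-cover-unique : ∀ {i a b x p r s s'} → IsPath P rk i a b (x ∷ p ∷ r) →
    Covers P x s → Covers P p s → Covers P x s' → Covers P p s' → s ≡ s'
  edge-cover-unique (vs , _ , (x≢ ∷ _) , _) =
    common-cover-unique (All.head x≢)
      (trans (vertex-rank vs (here refl)) (sym (vertex-rank vs (there (here refl)))))

  edge-path : ∀ {i p q} → AdjIn P (Whole P) rk i p q → IsPath P rk i p q (p ∷ q ∷ [])
  edge-path adj@(rp , rq , p≢q , _) =
    (tt , rp) ∷ (tt , rq) ∷ [] , adj ∷ [-] , (p≢q ∷ []) ∷ [] ∷ [] , refl , refl

  ideal-rank : ∀ x {r} → RankIn P (_≼ x) rk r → r ≡ rk x
  ideal-rank x (bound , _ , y≼x , ry) = ≤-antisym (subst (_≤ rk x) ry (rank-mono y≼x)) (bound x ≼.refl)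

  ideal-covers : ∀ x {p s} → CoversIn P (_≼ x) p s → Covers P p s × s ≼ x
  ideal-covers x (_ , s≼x , p≺s , between) =
    (tt , tt , p≺s , λ z _ p≺z z≺s → between z (≼.trans (proj₁ z≺s) s≼x) p≺z z≺s) , s≼x

  ideal-path : ∀ x {i p q l} → IsPathIn P (_≼ x) rk i p q l → IsPath P rk i p q l × All (_≼ x) l
  ideal-path x (vs , lk , uniq , h , t) =
    (All.map (λ v → tt , proj₂ v) vs , Linked.map adj lk , uniq , h , t) , All.map proj₁ vs
    where
    adj : ∀ {i p q} → AdjIn P (_≼ x) rk i p q → AdjIn P (Whole P) rk i p q
    adj (rp , rq , p≢q , s , rs , cp , cq) =
      rp , rq , p≢q , s , rs , proj₁ (ideal-covers x cp) , proj₁ (ideal-covers x cq)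

  ideal-tree-path : ∀ x {i p q} → 1 ≤ i → p ≼ x → q ≼ x → rk p ≡ i → rk q ≡ i →
    ∃[ l ] IsPathIn P (_≼ x) rk i p q l
  ideal-tree-path x {i} {p} {q} 1≤i p≼x q≼x rp rq with proj₁ (proj₂ (proj₂ lr x))
  ... | _ , rank-r , _ , trees =
    proj₂ (trees i 1≤i (subst (i ≤_) (sym (ideal-rank x rank-r)) (subst (_≤ rk x) rp (rank-mono p≼x))))
      p q (p≼x , rp) (q≼x , rq)

  ideal-connected : ∀ x {i p q} → 1 ≤ i → p ≼ x → q ≼ x → rk p ≡ i → rk q ≡ i →
    ∃[ l ] IsPath P rk i p q l × All (_≼ x) l
  ideal-connected x 1≤i p≼x q≼x rp rq with ideal-tree-path x 1≤i p≼x q≼x rp rq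
  ... | l , path = l , ideal-path x path

  -- The ideal below x is a tree at level i, so its path from p to q is the edge pq itself, whose
  -- cover inside the ideal is the unique common cover s.
  edge-below : ∀ x {i p q s} → 1 ≤ i → p ≼ x → q ≼ x → AdjIn P (Whole P) rk i p q →
    Covers P p s → Covers P q s → s ≼ x
  edge-below x {i} 1≤i p≼x q≼x adj@(rp , rq , p≢q , _) cps cqs with ideal-tree-path x 1≤i p≼x q≼x rp rq
  ... | l , pathᵢ
    with F.path-unique i (forest-of-path 1≤i (edge-path adj)) (edge-path adj) (proj₁ (ideal-path x pathᵢ))
  ... | refl with pathᵢ
  ... | _ , (_ , _ , _ , _ , _ , cps' , cqs') ∷ _ , _ with ideal-covers x cps' | ideal-covers x cqs'
  ... | cps'' , s'≼x | cqs'' , _ =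
    subst (_≼ x) (common-cover-unique p≢q (trans rp (sym rq)) cps'' cqs'' cps cqs) s'≼x

  FirstEdge-covers : ∀ {x p r s} → FirstEdge P (x ∷ p ∷ r) s → Covers P x s × Covers P p s
  FirstEdge-covers (_ , _ , _ , refl , cx , cp) = cx , cp

  FirstEdge⇒long : ∀ {l s} → FirstEdge P l s → 2 ≤ length l
  FirstEdge⇒long (_ , _ , _ , refl , _) = s≤s (s≤s z≤n)

  LastEdge⇒FirstEdge-reverse : ∀ {l t} → LastEdge P l t → FirstEdge P (reverse l) t
  LastEdge⇒FirstEdge-reverse (e , f , rest , refl , ce , cf) =
    f , e , reverse rest , reverse-++ rest (e ∷ f ∷ []) , cf , ce

  FirstEdge⇒LastEdge-reverse : ∀ {l s} → FirstEdge P l s → LastEdge P (reverse l) s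
  FirstEdge⇒LastEdge-reverse (p , q , r , refl , cp , cq) =
    q , p , reverse r , reverse-++ (p ∷ q ∷ []) r , cq , cp

  FirstEdge-covers-head : ∀ {i α β l s} → IsPath P rk i α β l → FirstEdge P l s → Covers P α s
  FirstEdge-covers-head (_ , _ , _ , h , _) (_ , _ , _ , refl , cp , _) =
    subst (λ y → Covers P y _) (just-injective h) cp

  LastEdge-covers-last : ∀ {i α β l t} → IsPath P rk i α β l → LastEdge P l t → Covers P β t
  LastEdge-covers-last {i} path le =
    FirstEdge-covers-head (F.path-reverse i path) (LastEdge⇒FirstEdge-reverse le)

  FirstEdge-shared : ∀ {i α β l₁ l₂ s s'} → IsPath P rk i α β l₁ → SameFirstStep l₁ l₂ →
    FirstEdge P l₁ s → FirstEdge P l₂ s' → s ≡ s'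
  FirstEdge-shared path (_ , _ , _ , _ , refl , refl) fe₁ fe₂ with FirstEdge-covers fe₁ | FirstEdge-covers fe₂
  ... | cx , cp | cx' , cp' = edge-cover-unique path cx cp cx' cp'

  next-level-path : ∀ {k α β l x} → IsPath P rk (suc k) α β l → All (_≼ x) l → 2 ≤ length l →
    ∃[ s ] ∃[ t ] ∃[ L ] FirstEdge P l s × LastEdge P l t × IsPath P rk (suc (suc k)) s t L × All (_≼ x) L
  next-level-path {l = []}    _ _ ()
  next-level-path {l = _ ∷ []} _ _ (s≤s ())
  next-level-path {l = p ∷ q ∷ r} {x} (_ , lk , _) below _ with Linked.head lk | Linked-last lk
  ... | adj₁@(_ , _ , _ , s , rs , cps , cqs) | rest , e , f , eq , adj₂@(_ , _ , _ , t , rt , cet , cft) =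
    let L , path , below' = ideal-connected x (s≤s z≤n) s≼x t≼x rs rt
    in s , t , L , (p , q , r , refl , cps , cqs) , (e , f , rest , eq , cet , cft) , path , below'
    where
    below-at : ∀ {z} → z ∈ p ∷ q ∷ r → z ≼ x
    below-at z∈ = All.lookup below z∈
    s≼x : s ≼ x
    s≼x = edge-below x (s≤s z≤n) (below-at (here refl)) (below-at (there (here refl))) adj₁ cps cqs
    t≼x : t ≼ x
    t≼x = edge-below x (s≤s z≤n) (below-at (subst (e ∈_) (sym eq) (∈-++⁺ʳ rest (here refl))))
            (below-at (subst (f ∈_) (sym eq) (∈-++⁺ʳ rest (there (here refl))))) adj₂ cet cft

  join-least : ∀ {a b x y} → IsJoin P a b x → a ≼ y → b ≼ y → x ≼ y
  join-least (_ , _ , least) = least _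

  IsJoin-comm : ∀ {a b x} → IsJoin P a b x → IsJoin P b a x
  IsJoin-comm (a≼x , b≼x , least) = b≼x , a≼x , λ y b≼y a≼y → least y a≼y b≼y

  JP-positive : ∀ {a b k l} → JP P rk a b k l → 1 ≤ k
  JP-positive {k = suc _} _ = s≤s z≤n

  JP-path : ∀ {a b} k {l} → JP P rk a b k l → ∃[ α ] ∃[ β ] IsPath P rk k α β l × a ≼ α × b ≼ β
  JP-path zero          ()
  JP-path (suc zero)    path = _ , _ , path , ≼.refl , ≼.refl
  JP-path (suc (suc k)) (_ , jp , s , t , fe , le , path) with JP-path (suc k) jp
  ... | _ , _ , path' , a≼α , b≼β =
    s , t , path , ≼.trans a≼α (covers⇒≼ (FirstEdge-covers-head path' fe)) ,
    ≼.trans b≼β (covers⇒≼ (LastEdge-covers-last path' le))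

  -- A single vertex y lying above both a and b would be above their join, hence equal to it.
  join-path-long : ∀ {a b x i α β l} → IsJoin P a b x → IsPath P rk i α β l → All (_≼ x) l →
    a ≼ α → b ≼ β → i < rk x → 2 ≤ length l
  join-path-long {l = []} _ (_ , _ , _ , () , _) _ _ _ _
  join-path-long {l = _ ∷ []} join ((_ , ry) ∷ [] , _ , _ , refl , refl) (y≼x ∷ []) a≼y b≼y i<x =
    ⊥-elim (<-irrefl (trans (sym ry) (cong rk (≼.antisym y≼x (join-least join a≼y b≼y)))) i<x)
  join-path-long {l = _ ∷ _ ∷ _} _ _ _ _ _ _ = s≤s (s≤s z≤n)

  level-one-path : ∀ {a b x} → Minimal P a → Minimal P b → IsJoin P a b x →
    ∃[ l ] IsPath P rk 1 a b l × All (_≼ x) l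
  level-one-path ma mb (a≼x , b≼x , _) = ideal-connected _ ≤-refl a≼x b≼x (rank-minimal ma) (rank-minimal mb)

  JP-exists : ∀ {a b x} → Minimal P a → Minimal P b → IsJoin P a b x → ∀ k → 1 ≤ k → k ≤ rk x →
    ∃[ l ] JP P rk a b k l × All (_≼ x) l
  JP-exists ma mb join (suc zero) _ _ = level-one-path ma mb join
  JP-exists ma mb join (suc (suc k)) _ k+2≤x
    with JP-exists ma mb join (suc k) (s≤s z≤n) (≤-trans (n≤1+n _) k+2≤x)
  ... | l , jp , below with JP-path (suc k) jp
  ... | _ , _ , path , a≼α , b≼β with next-level-path path below (join-path-long join path below a≼α b≼β k+2≤x)
  ... | s , t , L , fe , le , path' , below' = L , (l , jp , s , t , fe , le , path') , below'

  -- If the starts differ, l₂ begins with the first edge of l₁ reversed and ends on the last edge of l₁,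
  -- so it backtracks along l₁.
  end-edges-same-start : ∀ {i α₁ β₁ α₂ β₂ l₁ l₂ s t} → 1 ≤ i →
    IsPath P rk i α₁ β₁ l₁ → IsPath P rk i α₂ β₂ l₂ → FirstEdge P l₁ s → FirstEdge P l₂ s →
    LastEdge P l₁ t → LastEdge P l₂ t → s ≢ t → α₁ ≡ α₂
  end-edges-same-start {i} {β₂ = β₂} 1≤i
    path₁@(_ , _ , uniq₁@((p≢q ∷ _) ∷ _) , refl , _) path₂@(_ , _ , (p₂≢q₂ ∷ _) ∷ _ , refl , _)
    (p , q , r₁ , refl , cp , cq) (_ , _ , _ , refl , cp₂ , cq₂) (e , f , rest , eq , ce , cf) le₂ s≢t
    with covered-pair cp cq p≢q cp₂
  ... | inj₁ refl = refl
  ... | inj₂ refl with covered-pair cp cq p≢q cq₂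
  ...   | inj₂ refl = ⊥-elim (p₂≢q₂ refl)
  ...   | inj₁ refl = ⊥-elim (F.path-no-backtrack i (forest-of-path 1≤i path₁) path₁ path₂ β₂∈)
    where
    β₂∈ : β₂ ∈ q ∷ r₁
    β₂∈ with Unique-++⁻ʳ rest (subst Unique eq uniq₁)
    ... | (e≢f ∷ []) ∷ _ with covered-pair ce cf e≢f (LastEdge-covers-last path₂ le₂) | last-two rest eq
    ... | inj₁ refl | inj₁ (refl , refl) = ⊥-elim (s≢t (edge-cover-unique path₁ cp cq ce cf))
    ... | inj₁ refl | inj₂ (e∈ , _)      = e∈
    ... | inj₂ refl | inj₁ (_ , refl)    = here refl
    ... | inj₂ refl | inj₂ (_ , f∈)      = f∈

  end-edges-determine-path : ∀ {i α₁ β₁ α₂ β₂ l₁ l₂ s t} → 1 ≤ i →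
    IsPath P rk i α₁ β₁ l₁ → IsPath P rk i α₂ β₂ l₂ → FirstEdge P l₁ s → FirstEdge P l₂ s →
    LastEdge P l₁ t → LastEdge P l₂ t → s ≢ t → l₁ ≡ l₂
  end-edges-determine-path {i} 1≤i path₁ path₂ fe₁ fe₂ le₁ le₂ s≢t
    with end-edges-same-start 1≤i path₁ path₂ fe₁ fe₂ le₁ le₂ s≢t
       | end-edges-same-start 1≤i (F.path-reverse i path₁) (F.path-reverse i path₂)
           (LastEdge⇒FirstEdge-reverse le₁) (LastEdge⇒FirstEdge-reverse le₂)
           (FirstEdge⇒LastEdge-reverse fe₁) (FirstEdge⇒LastEdge-reverse fe₂) (λ t≡s → s≢t (sym t≡s))
  ... | refl | refl = F.path-unique i (forest-of-path 1≤i path₁) path₁ path₂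

  JP-end-injective : ∀ {a a' b b'} k {l} → JP P rk a b (suc k) l → JP P rk a' b' (suc k) l →
    2 ≤ length l → b ≡ b'
  JP-end-injective zero path path' _ = proj₂ (F.path-ends-unique 1 path path')
  JP-end-injective (suc k) (_ , jp₁ , _ , _ , fe₁ , le₁ , path) (_ , jp₂ , _ , _ , fe₂ , le₂ , path') long
    with F.path-ends-unique (suc (suc k)) path path'
  ... | refl , refl with JP-path (suc k) jp₁ | JP-path (suc k) jp₂
  ... | _ , _ , path₁ , _ | _ , _ , path₂ , _
    with end-edges-determine-path (s≤s z≤n) path₁ path₂ fe₁ fe₂ le₁ le₂ (F.path-ends-distinct _ path long)
  ... | refl = JP-end-injective k jp₁ jp₂ (FirstEdge⇒long fe₁)

  single-edge : ∀ {i α β l s} → IsPath P rk i α β l → FirstEdge P l s → LastEdge P l s → l ≡ α ∷ β ∷ []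
  single-edge path@(_ , _ , (p≢ ∷ uniq) , refl , t) (p , q , r , refl , cp , cq) le
    with covered-pair cp cq (All.head p≢) (LastEdge-covers-last path le)
  ... | inj₁ refl = ⊥-elim (Unique-∷⁻ (p≢ ∷ uniq) (last⇒∈ {l = q ∷ r} t))
  ... | inj₂ refl = cong (λ r → p ∷ q ∷ r) (Unique-last-head uniq t)

  path-at-top : ∀ {i x α β L} → rk x ≡ i → IsPath P rk i α β L → All (_≼ x) L → α ≡ x × β ≡ x
  path-at-top rk-x (vs , _ , _ , h , t) below = at (head⇒∈ h) , at (last⇒∈ t)
    where
    at : ∀ {y} → y ∈ _ → y ≡ _
    at y∈ = ≼-rank-≡ (All.lookup below y∈) (trans (vertex-rank vs y∈) (sym rk-x))

  join-rank-≥2 : ∀ {a b x} → Minimal P a → a ≢ b → IsJoin P a b x → 2 ≤ rk x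
  join-rank-≥2 {b = b} {x} ma a≢b (a≼x , b≼x , _) =
    subst (_< rk x) (rank-minimal ma) (rank-< (a≼x , λ { refl → a≢b (sym (proj₂ ma b tt b≼x)) }))

  -- At the top level both joining paths are the single edge E(x). That of a ∨ b runs from above a to
  -- above b, and that of a ∨ c cannot run backwards (its start would be above a and b, hence above x),
  -- so the two joining paths coincide, and so do their ends.
  join-cancelˡ : ∀ {a b c x} → Minimal P a → Minimal P b → Minimal P c → a ≢ b →
    IsJoin P a b x → IsJoin P a c x → b ≡ c
  join-cancelˡ {b = b} {c} {x} ma mb mc a≢b join₁ join₂ = at-level (join-rank-≥2 ma a≢b join₁) refl
    where
    at-level : ∀ {m} → 2 ≤ m → rk x ≡ m → b ≡ c
    at-level {suc zero} (s≤s ()) _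
    at-level {suc (suc j)} _ rk-x
      with JP-exists ma mb join₁ (suc (suc j)) (s≤s z≤n) (≤-reflexive (sym rk-x))
         | JP-exists ma mc join₂ (suc (suc j)) (s≤s z≤n) (≤-reflexive (sym rk-x))
    ... | _ , (_ , jp₁ , _ , _ , fe₁ , le₁ , top₁) , below₁ | _ , (_ , jp₂ , _ , _ , fe₂ , le₂ , top₂) , below₂
      with path-at-top rk-x top₁ below₁ | path-at-top rk-x top₂ below₂
    ... | refl , refl | refl , refl with JP-path (suc j) jp₁ | JP-path (suc j) jp₂
    ... | _ , _ , path₁ , _ , b≼β₁ | _ , _ , path₂ , a≼α₂ , _
      with single-edge path₁ fe₁ le₁ | single-edge path₂ fe₂ le₂
    ... | refl | refl with FirstEdge-covers fe₁ | FirstEdge-covers fe₂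
    ... | cα₁ , cβ₁ | cα₂ , cβ₂ with covered-pair cα₁ cβ₁ (F.path-ends-distinct _ path₁ (s≤s (s≤s z≤n))) cα₂
    ... | inj₂ refl = ⊥-elim (covers⇒≢ cβ₁ (≼.antisym (covers⇒≼ cβ₁) (join-least join₁ a≼α₂ b≼β₁)))
    ... | inj₁ refl with covered-pair cα₁ cβ₁ (F.path-ends-distinct _ path₁ (s≤s (s≤s z≤n))) cβ₂
    ...   | inj₁ refl = ⊥-elim (F.path-ends-distinct _ path₂ (s≤s (s≤s z≤n)) refl)
    ...   | inj₂ refl = JP-end-injective j jp₁ jp₂ (s≤s (s≤s z≤n))

  distinct-joins : ∀ {a b c x y} → Minimal P a → Minimal P b → Minimal P c → a ≢ b → b ≢ c →
    IsJoin P a b x → IsJoin P a c y → x ≢ y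
  distinct-joins ma mb mc a≢b b≢c join₁ join₂ refl = b≢c (join-cancelˡ ma mb mc a≢b join₁ join₂)

  module Joins {a b c u v w} (ma : Minimal P a) (mb : Minimal P b) (mc : Minimal P c)
    (join-u : IsJoin P a b u) (join-v : IsJoin P b c v) (join-w : IsJoin P a c w) where

    record Triangle (k : ℕ) : Set where
      field
        α β γ    : El P
        pu pv pw : List (El P)
        jp-u     : JP P rk a b k pu
        jp-v     : JP P rk b c k pv
        jp-w     : JP P rk a c k pw
        below-u  : All (_≼ u) pu
        below-v  : All (_≼ v) pv
        below-w  : All (_≼ w) pw
        path-u   : IsPath P rk k α β pu
        path-v   : IsPath P rk k β γ pv
        path-w   : IsPath P rk k α γ pw
        a≼α      : a ≼ α
        b≼β      : b ≼ β
        c≼γ      : c ≼ γ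

    UpperBound : El P → Set
    UpperBound x = a ≼ x × b ≼ x × c ≼ x

    Conclusion : Set
    Conclusion =
      (∃[ k ] 1 ≤ k × k ≤ n ×
        (∃[ pu ] ∃[ pv ] ∃[ pw ]
          JoiningPath P rk a b u k pu × JoiningPath P rk b c v k pv × JoiningPath P rk a c w k pw ×
          (ConcatOf pu pv pw ⊎ ConcatOf pv pu pw ⊎ ConcatOf pw pu pv)))
      × (UpperBound u ⊎ UpperBound v ⊎ UpperBound w)

    triangle₁ : Triangle 1
    triangle₁ with level-one-path ma mb join-u | level-one-path mb mc join-v | level-one-path ma mc join-w
    ... | pu , path-u , below-u | pv , path-v , below-v | pw , path-w , below-w = record
      { α = a ; β = b ; γ = c ; pu = pu ; pv = pv ; pw = pw
      ; jp-u = path-u ; jp-v = path-v ; jp-w = path-w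
      ; below-u = below-u ; below-v = below-v ; below-w = below-w
      ; path-u = path-u ; path-v = path-v ; path-w = path-w
      ; a≼α = ≼.refl ; b≼β = ≼.refl ; c≼γ = ≼.refl
      }

    joining-path : ∀ {a' b' x k α β l} → IsJoin P a' b' x → JP P rk a' b' k l → IsPath P rk k α β l →
      All (_≼ x) l → JoiningPath P rk a' b' x k l
    joining-path join jp path below = join , JP-positive jp , path-level-≤ path below , jp

    module AtLevel {k} (t : Triangle (suc k)) where
      open Triangle t

      ConcatenationThroughCorner : Set
      ConcatenationThroughCorner =
        (γ ∈ pu × ConcatOf pu pv pw) ⊎ (α ∈ pv × ConcatOf pv pu pw) ⊎ (β ∈ pw × ConcatOf pw pu pv)

      conclude : ConcatenationThroughCorner → Conclusion
      conclude concat =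
        (suc k , s≤s z≤n , ≤-trans (path-level-≤ path-u below-u) (rank-≤-n u) , pu , pv , pw ,
          joining-path join-u jp-u path-u below-u , joining-path join-v jp-v path-v below-v ,
          joining-path join-w jp-w path-w below-w , Sum.map proj₂ (Sum.map proj₂ proj₂) concat) ,
        upper-bound concat
        where
        upper-bound : ConcatenationThroughCorner → UpperBound u ⊎ UpperBound v ⊎ UpperBound w
        upper-bound (inj₁ (γ∈ , _)) =
          inj₁ (proj₁ join-u , proj₁ (proj₂ join-u) , ≼.trans c≼γ (All.lookup below-u γ∈))
        upper-bound (inj₂ (inj₁ (α∈ , _))) =
          inj₂ (inj₁ (≼.trans a≼α (All.lookup below-v α∈) , proj₁ join-v , proj₁ (proj₂ join-v)))
        upper-bound (inj₂ (inj₂ (β∈ , _))) =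
          inj₂ (inj₂ (proj₁ join-w , ≼.trans b≼β (All.lookup below-w β∈) , proj₁ (proj₂ join-w)))

      ascend : SharedCorners pu pv pw → Triangle (suc (suc k))
      ascend (same-α , same-β , same-γ)
        with next-level-path path-u below-u (proj₁ (SameFirstStep⇒long same-α))
           | next-level-path path-v below-v (proj₂ (SameFirstStep⇒long same-β))
           | next-level-path path-w below-w (proj₂ (SameFirstStep⇒long same-α))
      ... | su , tu , Lu , feu , leu , path-u' , below-u' | _ , tv , Lv , fev , lev , path-v' , below-v'
          | _ , tw , Lw , few , lew , path-w' , below-w'
        with FirstEdge-shared path-u same-α feu few
           | FirstEdge-shared (F.path-reverse _ path-u) same-β (LastEdge⇒FirstEdge-reverse leu) fev
           | FirstEdge-shared (F.path-reverse _ path-v) same-γ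
               (LastEdge⇒FirstEdge-reverse lev) (LastEdge⇒FirstEdge-reverse lew)
      ... | refl | refl | refl = record
        { α = su ; β = tu ; γ = tv ; pu = Lu ; pv = Lv ; pw = Lw
        ; jp-u = pu , jp-u , su , tu , feu , leu , path-u'
        ; jp-v = pv , jp-v , tu , tv , fev , lev , path-v'
        ; jp-w = pw , jp-w , su , tv , few , lew , path-w'
        ; below-u = below-u' ; below-v = below-v' ; below-w = below-w'
        ; path-u = path-u' ; path-v = path-v' ; path-w = path-w'
        ; a≼α = ≼.trans a≼α (covers⇒≼ (FirstEdge-covers-head path-u feu))
        ; b≼β = ≼.trans b≼β (covers⇒≼ (LastEdge-covers-last path-u leu))
        ; c≼γ = ≼.trans c≼γ (covers⇒≼ (LastEdge-covers-last path-v lev))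
        }

      advance : Conclusion ⊎ Triangle (suc (suc k))
      advance with F.triangle (suc k) (forest-of-path (s≤s z≤n) path-u) path-u path-v path-w
      ... | inj₁ at-γ                  = inj₁ (conclude (inj₁ at-γ))
      ... | inj₂ (inj₁ at-α)           = inj₁ (conclude (inj₂ (inj₁ at-α)))
      ... | inj₂ (inj₂ (inj₁ at-β))    = inj₁ (conclude (inj₂ (inj₂ at-β)))
      ... | inj₂ (inj₂ (inj₂ shared))  = inj₂ (ascend shared)

    climb : ∀ m {k} → rk u ≤ m + suc k → Triangle (suc k) → Conclusion
    climb m rk-u t with AtLevel.advance t
    climb m       _    _ | inj₁ done = done
    climb zero    rk-u _ | inj₂ t'   = ⊥-elim (1+n≰n (≤-trans (path-level-≤ (path-u t') (below-u t')) rk-u))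
      where open Triangle
    climb (suc m) {k} rk-u _ | inj₂ t' = climb m (subst (rk u ≤_) (sym (+-suc m (suc k))) rk-u) t'

    conclusion : Conclusion
    conclusion = climb (rk u) (m≤m+n (rk u) 1) triangle₁

    module _ (a≢b : a ≢ b) (b≢c : b ≢ c) (a≢c : a ≢ c) where

      u≢v : u ≢ v
      u≢v = distinct-joins mb ma mc (≢-sym a≢b) a≢c (IsJoin-comm join-u) join-v

      u≢w : u ≢ w
      u≢w = distinct-joins ma mb mc a≢b b≢c join-u join-w

      v≢w : v ≢ w
      v≢w = distinct-joins mc mb ma (≢-sym b≢c) (≢-sym a≢b) (IsJoin-comm join-v) (IsJoin-comm join-w)

      strictly-above : UpperBound u ⊎ UpperBound v ⊎ UpperBound w →
        (_≺_ P v u × _≺_ P w u) ⊎ (_≺_ P u v × _≺_ P w v) ⊎ (_≺_ P u w × _≺_ P v w)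
      strictly-above (inj₁ (a≼u , b≼u , c≼u)) =
        inj₁ ((join-least join-v b≼u c≼u , ≢-sym u≢v) , (join-least join-w a≼u c≼u , ≢-sym u≢w))
      strictly-above (inj₂ (inj₁ (a≼v , b≼v , c≼v))) =
        inj₂ (inj₁ ((join-least join-u a≼v b≼v , u≢v) , (join-least join-w a≼v c≼v , ≢-sym v≢w)))
      strictly-above (inj₂ (inj₂ (a≼w , b≼w , c≼w))) =
        inj₂ (inj₂ ((join-least join-u a≼w b≼w , u≢w) , (join-least join-v b≼w c≼w , v≢w)))

lemma5p15 : (P : FinPoset) (rk : El P → ℕ) (n : ℕ) →
    IsLRVine P rk → Rank P rk n →
    (a b c u v w : El P) →
    a ≢ b → b ≢ c → a ≢ c →
    Minimal P a → Minimal P b → Minimal P c →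
    IsJoin P a b u → IsJoin P b c v → IsJoin P a c w →
    (∃[ k ] 1 ≤ k × k ≤ n ×
      (∃[ pu ] ∃[ pv ] ∃[ pw ]
        JoiningPath P rk a b u k pu × JoiningPath P rk b c v k pv ×
        JoiningPath P rk a c w k pw ×
        (ConcatOf pu pv pw ⊎ ConcatOf pv pu pw ⊎ ConcatOf pw pu pv)))
    ×
    ((_≺_ P v u × _≺_ P w u) ⊎ (_≺_ P u v × _≺_ P w v) ⊎ (_≺_ P u w × _≺_ P v w))
lemma5p15 P rk n lr rank-n a b c u v w a≢b b≢c a≢c ma mb mc join-u join-v join-w =
  proj₁ conclusion , strictly-above a≢b b≢c a≢c (proj₂ conclusion)
  where
  open Vine P rk n lr rank-n
  open Joins ma mb mc join-u join-v join-w
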